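{- Let $\pi\in\mathrm{Dis}(v,e)$ have diagonal sequence $\delta(\pi)=(\delta_1,\dots,\delta_T)$. Then $P_2(\mathrm{Th}(\pi))=2\,\delta(\pi)\cdot(1,2,\dots,T)=2\sum_{i=1}^T i\,\delta_i$.
   Context: $\mathrm{Dis}(v,e)$ is the set of partitions $\pi=(a_0,\dots,a_p)$ of $e$ into distinct parts with $v>a_0>\dots>a_p>0$. The threshold graph $\mathrm{Th}(\pi)$ has vertex set $\{0,\dots,v-1\}$ and, for $s=0,\dots,p$, edges $\{s,s+1\},\{s,s+2\},\dots,\{s,s+a_s\}$. $P_2(G)$ is the sum of the squares of the degrees of $G$. The diagonal sequence $\delta(\pi)=(\delta_1,\dots,\delta_T)$: $\delta_i$ is the number of pairs $(s,t)$ with $0\le s\le p$, $s+1\le t\le s+a_s$ and $s+t=i$, and $T$ is the largest value of $s+t$ over such pairs. -}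

module Defs where

open import Data.Nat using (ℕ; zero; suc; _+_; _*_; _<_; _>_; _⊔_; _^_)
open import Data.Nat.Properties using (_≟_)
open import Data.Product using (_×_; _,_; proj₁; proj₂)
open import Data.List using (List; []; _∷_; _++_; map; length; filter; foldr; applyUpTo)
open import Data.Nat.ListAction using (sum)
open import Data.List.Relation.Unary.All using (All)
open import Data.List.Relation.Unary.Linked using (Linked)
open import Relation.Nullary.Decidable using (_⊎-dec_)
open import Relation.Binary.PropositionalEquality using (_≡_)

record Dis (v e : ℕ) (π : List ℕ) : Set where
  field
    decreasing : Linked _>_ π
    positive   : All (0 <_) π
    bounded    : All (_< v) π
    sumIs      : sum π ≡ e

-- Edges {s, s+1}, …, {s, s+a_s} for the entry a_s at position s
-- (recorded as ordered pairs (s , t) with s < t).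
edgesFrom : ℕ → List ℕ → List (ℕ × ℕ)
edgesFrom s []       = []
edgesFrom s (a ∷ as) = map (λ j → (s , s + j)) (applyUpTo suc a) ++ edgesFrom (suc s) as

thEdges : List ℕ → List (ℕ × ℕ)
thEdges π = edgesFrom 0 π

degree : List (ℕ × ℕ) → ℕ → ℕ
degree E x = length (filter (λ st → (proj₁ st ≟ x) ⊎-dec (proj₂ st ≟ x)) E)

P₂ : ℕ → List (ℕ × ℕ) → ℕ
P₂ v E = sum (map (λ x → degree E x ^ 2) (applyUpTo (λ x → x) v))

diag : List ℕ → ℕ → ℕ
diag π i = length (filter (λ st → (proj₁ st + proj₂ st) ≟ i) (thEdges π))

diagLen : List ℕ → ℕ
diagLen π = foldr _⊔_ 0 (map (λ st → proj₁ st + proj₂ st) (thEdges π))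

weightedDiag : List ℕ → ℕ
weightedDiag π = sum (map (λ i → i * diag π i) (applyUpTo suc (diagLen π)))

module Submission where

-- Write d_π for the degree function of Th(π) and σ(E) = Σ_{(s,t) ∈ E} (s + t).
-- The right-hand side is a histogram of the edge weights s + t, so it equals
-- 2·σ(Th(π)) (lemma weightedDiag≡edgeWeight).  For the left-hand side we peel
-- off the first part: the edges of Th(a ∷ π') are the star {0,1},…,{0,a}
-- followed by the edges of Th(π') shifted by one vertex.  Hence
--   d_{a∷π'}(0) = a   and   d_{a∷π'}(y+1) = [y < a] + d_{π'}(y).
-- Because a > a₁ > a₂ > ⋯, every vertex of Th(π') carrying an edge lies below a,
-- so d_{π'}(y) = 0 unless y < a.  Then ([y < a] + d_{π'}(y))² expands to
-- [y < a] + 2·d_{π'}(y) + d_{π'}(y)², and summing over the vertices gives,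
-- together with the handshake lemma Σ d_{π'} = 2|E(π')|, the recursion
--   Σ_x d_π(x)² = a² + a + 4|E(π')| + Σ_y d_{π'}(y)²,
-- which matches σ(E(a ∷ π')) = (1 + ⋯ + a) + σ(E(π')) + 2|E(π')|.

open import Defs
open import Data.Bool using (Bool; true; false)
open import Data.Nat using (ℕ; zero; suc; _+_; _*_; _≤_; _<_; _>_; _^_; _⊔_; s≤s)
open import Data.Nat.Properties
open import Algebra.Properties.CommutativeSemigroup +-commutativeSemigroup using (interchange)
open import Data.Nat.Tactic.RingSolver using (solve-∀)
open import Data.Nat.ListAction using (sum)
open import Data.Nat.ListAction.Properties using (sum-++)
open import Data.Product using (_×_; _,_; proj₁; proj₂)
open import Data.Sum using (_⊎_)
open import Data.List using (List; []; _∷_; _++_; map; length; filter; foldr; applyUpTo)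
open import Data.List.Properties
  using (map-applyUpTo; applyUpTo-∷ʳ; map-++; map-∘; map-cong; length-++; length-map; length-applyUpTo; filter-++)
open import Data.List.Relation.Unary.All as All using ()
open import Data.List.Relation.Unary.Linked using (Linked; [-]; _∷_)
open import Relation.Nullary.Decidable using (does; yes; no; _⊎-dec_; dec-true; dec-false)
open import Relation.Nullary using (contradiction)
open import Relation.Unary using (Decidable)
open import Relation.Binary.PropositionalEquality
open import Function using (_∘_)
open ≡-Reasoning

𝟙 : Bool → ℕ
𝟙 true  = 1
𝟙 false = 0

below : ℕ → ℕ → ℕ
below y a = 𝟙 (does (y <? a))

below-yes : ∀ {y a} → y < a → below y a ≡ 1
below-yes {y} {a} y<a = cong 𝟙 (dec-true (y <? a) y<a)

below-no : ∀ {y a} → a ≤ y → below y a ≡ 0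
below-no {y} {a} a≤y = cong 𝟙 (dec-false (y <? a) (≤⇒≯ a≤y))

does-≟-sym : ∀ m n → does (m ≟ n) ≡ does (n ≟ m)
does-≟-sym zero    zero    = refl
does-≟-sym zero    (suc n) = refl
does-≟-sym (suc m) zero    = refl
does-≟-sym (suc m) (suc n) = does-≟-sym m n

Σ : ℕ → (ℕ → ℕ) → ℕ
Σ n g = sum (applyUpTo g n)

Σ-cong : ∀ n {f g : ℕ → ℕ} → (∀ x → f x ≡ g x) → Σ n f ≡ Σ n g
Σ-cong zero    f≗g = refl
Σ-cong (suc n) f≗g = cong₂ _+_ (f≗g 0) (Σ-cong n (f≗g ∘ suc))

Σ-zero : ∀ n → Σ n (λ _ → 0) ≡ 0
Σ-zero zero    = refl
Σ-zero (suc n) = Σ-zero n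

Σ-ones : ∀ n → Σ n (λ _ → 1) ≡ n
Σ-ones zero    = refl
Σ-ones (suc n) = cong suc (Σ-ones n)

Σ-+ : ∀ n (f g : ℕ → ℕ) → Σ n (λ x → f x + g x) ≡ Σ n f + Σ n g
Σ-+ zero    f g = refl
Σ-+ (suc n) f g = begin
  f 0 + g 0 + Σ n (λ x → f (suc x) + g (suc x))   ≡⟨ cong (f 0 + g 0 +_) (Σ-+ n (f ∘ suc) (g ∘ suc)) ⟩
  f 0 + g 0 + (Σ n (f ∘ suc) + Σ n (g ∘ suc))     ≡⟨ interchange (f 0) (g 0) _ _ ⟩
  f 0 + Σ n (f ∘ suc) + (g 0 + Σ n (g ∘ suc))     ∎

Σ-* : ∀ n c (f : ℕ → ℕ) → Σ n (λ x → c * f x) ≡ c * Σ n f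
Σ-* zero    c f = sym (*-zeroʳ c)
Σ-* (suc n) c f = trans (cong (c * f 0 +_) (Σ-* n c (f ∘ suc))) (sym (*-distribˡ-+ c (f 0) _))

Σ-last : ∀ n (g : ℕ → ℕ) → Σ (suc n) g ≡ Σ n g + g n
Σ-last n g = begin
  sum (applyUpTo g (suc n))            ≡⟨ cong sum (sym (applyUpTo-∷ʳ g n)) ⟩
  sum (applyUpTo g n ++ g n ∷ [])      ≡⟨ sum-++ (applyUpTo g n) (g n ∷ []) ⟩
  Σ n g + (g n + 0)                    ≡⟨ cong (Σ n g +_) (+-identityʳ (g n)) ⟩
  Σ n g + g n                          ∎

gauss : ∀ a → 2 * Σ a suc ≡ a * a + a
gauss zero    = refl
gauss (suc a) = begin
  2 * Σ (suc a) suc              ≡⟨ cong (2 *_) (Σ-last a suc) ⟩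
  2 * (Σ a suc + suc a)          ≡⟨ *-distribˡ-+ 2 (Σ a suc) (suc a) ⟩
  2 * Σ a suc + 2 * suc a        ≡⟨ cong (_+ 2 * suc a) (gauss a) ⟩
  a * a + a + 2 * suc a          ≡⟨ square-step a ⟩
  suc a * suc a + suc a          ∎
  where
  square-step : ∀ a → a * a + a + 2 * (1 + a) ≡ (1 + a) * (1 + a) + (1 + a)
  square-step = solve-∀

Σ-below : ∀ n a → a ≤ n → Σ n (λ y → below y a) ≡ a
Σ-below n       zero    _         = Σ-zero n
Σ-below (suc n) (suc a) (s≤s a≤n) = cong suc (Σ-below n a a≤n)

Σ-point : ∀ n y (w : ℕ → ℕ) → Σ n (λ j → 𝟙 (does (y ≟ j)) * w j) ≡ below y n * w y
Σ-point zero    y       w = refl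
Σ-point (suc n) zero    w =
  trans (cong (1 * w 0 +_) (Σ-zero n)) (+-identityʳ (1 * w 0))
Σ-point (suc n) (suc y) w = Σ-point n y (w ∘ suc)

length-filter-∷ : ∀ {A : Set} {P : A → Set} (P? : Decidable P) x xs →
  length (filter P? (x ∷ xs)) ≡ 𝟙 (does (P? x)) + length (filter P? xs)
length-filter-∷ P? x xs with does (P? x)
... | true  = refl
... | false = refl

length-filter-applyUpTo : ∀ {A : Set} {P : A → Set} (P? : Decidable P) n (g : ℕ → A) →
  length (filter P? (applyUpTo g n)) ≡ Σ n (λ j → 𝟙 (does (P? (g j))))
length-filter-applyUpTo P? zero    g = refl
length-filter-applyUpTo P? (suc n) g =
  trans (length-filter-∷ P? (g 0) (applyUpTo (g ∘ suc) n))
        (cong (𝟙 (does (P? (g 0))) +_) (length-filter-applyUpTo P? n (g ∘ suc)))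

histogram : ∀ {A : Set} (w : A → ℕ) (E : List A) T → foldr _⊔_ 0 (map w E) ≤ T →
  sum (map (λ i → i * length (filter (λ e → w e ≟ i) E)) (applyUpTo suc T)) ≡ sum (map w E)
histogram w []      T _ = sum-zeros (applyUpTo suc T)
  where
  sum-zeros : ∀ is → sum (map (λ i → i * 0) is) ≡ 0
  sum-zeros []       = refl
  sum-zeros (i ∷ is) = cong₂ _+_ (*-zeroʳ i) (sum-zeros is)
histogram {A} w (e ∷ E) T bound = begin
  sum (map (λ i → i * count (e ∷ E) i) range)
    ≡⟨ cong sum (map-cong (λ i → split i) range) ⟩
  sum (map (λ i → i * 𝟙 (does (w e ≟ i)) + i * count E i) range)
    ≡⟨ sum-map-+ (λ i → i * 𝟙 (does (w e ≟ i))) (λ i → i * count E i) range ⟩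
  sum (map (λ i → i * 𝟙 (does (w e ≟ i))) range) + sum (map (λ i → i * count E i) range)
    ≡⟨ cong₂ _+_ (picks (w e) T (m⊔n≤o⇒m≤o (w e) _ bound))
                 (histogram w E T (m⊔n≤o⇒n≤o (w e) _ bound)) ⟩
  w e + sum (map w E) ∎
  where
  range = applyUpTo suc T

  count : List A → ℕ → ℕ
  count E i = length (filter (λ e → w e ≟ i) E)

  split : ∀ i → i * count (e ∷ E) i ≡ i * 𝟙 (does (w e ≟ i)) + i * count E i
  split i = trans (cong (i *_) (length-filter-∷ (λ e → w e ≟ i) e E)) (*-distribˡ-+ i _ _)

  sum-map-+ : ∀ (f g : ℕ → ℕ) is → sum (map (λ i → f i + g i) is) ≡ sum (map f is) + sum (map g is)
  sum-map-+ f g []       = refl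
  sum-map-+ f g (i ∷ is) = trans (cong (f i + g i +_) (sum-map-+ f g is)) (interchange (f i) (g i) _ _)

  picks : ∀ x T → x ≤ T → sum (map (λ i → i * 𝟙 (does (x ≟ i))) (applyUpTo suc T)) ≡ x
  picks x T x≤T = trans (cong sum (map-applyUpTo suc _ T)) (picks-Σ x x≤T)
    where
    picks-Σ : ∀ x → x ≤ T → Σ T (λ j → suc j * 𝟙 (does (x ≟ suc j))) ≡ x
    picks-Σ zero    _   = trans (Σ-cong T (λ j → *-zeroʳ (suc j))) (Σ-zero T)
    picks-Σ (suc y) y<T = begin
      Σ T (λ j → suc j * 𝟙 (does (y ≟ j)))   ≡⟨ Σ-cong T (λ j → *-comm (suc j) _) ⟩
      Σ T (λ j → 𝟙 (does (y ≟ j)) * suc j)   ≡⟨ Σ-point T y suc ⟩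
      below y T * suc y                      ≡⟨ cong (_* suc y) (below-yes y<T) ⟩
      1 * suc y                              ≡⟨ *-identityˡ (suc y) ⟩
      suc y                                  ∎

weight : ℕ × ℕ → ℕ
weight (s , t) = s + t

edgeWeight : List (ℕ × ℕ) → ℕ
edgeWeight E = sum (map weight E)

shift : ℕ × ℕ → ℕ × ℕ
shift (s , t) = (suc s , suc t)

star : ℕ → List (ℕ × ℕ)
star a = applyUpTo (λ j → (0 , suc j)) a

edgeWeight-++ : ∀ E₁ E₂ → edgeWeight (E₁ ++ E₂) ≡ edgeWeight E₁ + edgeWeight E₂
edgeWeight-++ E₁ E₂ = trans (cong sum (map-++ weight E₁ E₂)) (sum-++ (map weight E₁) (map weight E₂))

edgeWeight-shift : ∀ E → edgeWeight (map shift E) ≡ edgeWeight E + 2 * length E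
edgeWeight-shift []            = refl
edgeWeight-shift ((s , t) ∷ E) =
  trans (cong (suc s + suc t +_) (edgeWeight-shift E)) (regroup s t (edgeWeight E) (length E))
  where
  regroup : ∀ s t σ m → suc s + suc t + (σ + 2 * m) ≡ s + t + σ + 2 * suc m
  regroup = solve-∀

edgeWeight-star : ∀ a → edgeWeight (star a) ≡ Σ a suc
edgeWeight-star a = cong sum (map-applyUpTo (λ j → (0 , suc j)) weight a)

incident? : (x : ℕ) → Decidable (λ (st : ℕ × ℕ) → proj₁ st ≡ x ⊎ proj₂ st ≡ x)
incident? x st = (proj₁ st ≟ x) ⊎-dec (proj₂ st ≟ x)

degree-++ : ∀ E₁ E₂ x → degree (E₁ ++ E₂) x ≡ degree E₁ x + degree E₂ x
degree-++ E₁ E₂ x = trans (cong length (filter-++ (incident? x) E₁ E₂)) (length-++ (filter (incident? x) E₁))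

degree-shift-zero : ∀ E → degree (map shift E) 0 ≡ 0
degree-shift-zero []      = refl
degree-shift-zero (e ∷ E) = degree-shift-zero E

degree-shift-suc : ∀ E x → degree (map shift E) (suc x) ≡ degree E x
degree-shift-suc []      x = refl
degree-shift-suc (e ∷ E) x = begin
  degree (shift e ∷ map shift E) (suc x)
    ≡⟨ length-filter-∷ (incident? (suc x)) (shift e) (map shift E) ⟩
  𝟙 (does (incident? x e)) + degree (map shift E) (suc x)
    ≡⟨ cong (𝟙 (does (incident? x e)) +_) (degree-shift-suc E x) ⟩
  𝟙 (does (incident? x e)) + degree E x
    ≡⟨ sym (length-filter-∷ (incident? x) e E) ⟩
  degree (e ∷ E) x ∎

degree-star-zero : ∀ a → degree (star a) 0 ≡ a
degree-star-zero a = trans (length-filter-applyUpTo (incident? 0) a (λ j → (0 , suc j))) (Σ-ones a)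

degree-star-suc : ∀ a y → degree (star a) (suc y) ≡ below y a
degree-star-suc a y = begin
  degree (star a) (suc y)               ≡⟨ length-filter-applyUpTo (incident? (suc y)) a (λ j → (0 , suc j)) ⟩
  Σ a (λ j → 𝟙 (does (j ≟ y)))         ≡⟨ Σ-cong a (λ j → trans (cong 𝟙 (does-≟-sym j y)) (sym (*-identityʳ _))) ⟩
  Σ a (λ j → 𝟙 (does (y ≟ j)) * 1)     ≡⟨ Σ-point a y (λ _ → 1) ⟩
  below y a * 1                         ≡⟨ *-identityʳ (below y a) ⟩
  below y a                             ∎

edgesFrom-suc : ∀ s π → edgesFrom (suc s) π ≡ map shift (edgesFrom s π)
edgesFrom-suc s []       = refl
edgesFrom-suc s (a ∷ as) = begin
  map (λ j → (suc s , suc s + j)) (applyUpTo suc a) ++ edgesFrom (suc (suc s)) as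
    ≡⟨ cong₂ _++_ (map-∘ (applyUpTo suc a)) (edgesFrom-suc (suc s) as) ⟩
  map shift (map (λ j → (s , s + j)) (applyUpTo suc a)) ++ map shift (edgesFrom (suc s) as)
    ≡⟨ sym (map-++ shift (map (λ j → (s , s + j)) (applyUpTo suc a)) (edgesFrom (suc s) as)) ⟩
  map shift (edgesFrom s (a ∷ as)) ∎

thEdges-∷ : ∀ a π → thEdges (a ∷ π) ≡ star a ++ map shift (thEdges π)
thEdges-∷ a π = cong₂ _++_ (map-applyUpTo suc (λ j → (0 , j)) a) (edgesFrom-suc 0 π)

length-thEdges-∷ : ∀ a π → length (thEdges (a ∷ π)) ≡ a + length (thEdges π)
length-thEdges-∷ a π = begin
  length (thEdges (a ∷ π))                             ≡⟨ cong length (thEdges-∷ a π) ⟩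
  length (star a ++ map shift (thEdges π))             ≡⟨ length-++ (star a) ⟩
  length (star a) + length (map shift (thEdges π))     ≡⟨ cong₂ _+_ (length-applyUpTo _ a) (length-map shift (thEdges π)) ⟩
  a + length (thEdges π)                               ∎

edgeWeight-thEdges-∷ : ∀ a π →
  edgeWeight (thEdges (a ∷ π)) ≡ Σ a suc + (edgeWeight (thEdges π) + 2 * length (thEdges π))
edgeWeight-thEdges-∷ a π = begin
  edgeWeight (thEdges (a ∷ π))                               ≡⟨ cong edgeWeight (thEdges-∷ a π) ⟩
  edgeWeight (star a ++ map shift (thEdges π))               ≡⟨ edgeWeight-++ (star a) _ ⟩
  edgeWeight (star a) + edgeWeight (map shift (thEdges π))   ≡⟨ cong₂ _+_ (edgeWeight-star a) (edgeWeight-shift (thEdges π)) ⟩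
  Σ a suc + (edgeWeight (thEdges π) + 2 * length (thEdges π)) ∎

thDegree : List ℕ → ℕ → ℕ
thDegree π x = degree (thEdges π) x

thDegree-zero : ∀ a π → thDegree (a ∷ π) 0 ≡ a
thDegree-zero a π = begin
  degree (thEdges (a ∷ π)) 0                               ≡⟨ cong (λ E → degree E 0) (thEdges-∷ a π) ⟩
  degree (star a ++ map shift (thEdges π)) 0               ≡⟨ degree-++ (star a) _ 0 ⟩
  degree (star a) 0 + degree (map shift (thEdges π)) 0     ≡⟨ cong₂ _+_ (degree-star-zero a) (degree-shift-zero (thEdges π)) ⟩
  a + 0                                                    ≡⟨ +-identityʳ a ⟩
  a                                                        ∎

thDegree-suc : ∀ a π y → thDegree (a ∷ π) (suc y) ≡ below y a + thDegree π y
thDegree-suc a π y = begin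
  degree (thEdges (a ∷ π)) (suc y)                               ≡⟨ cong (λ E → degree E (suc y)) (thEdges-∷ a π) ⟩
  degree (star a ++ map shift (thEdges π)) (suc y)               ≡⟨ degree-++ (star a) _ (suc y) ⟩
  degree (star a) (suc y) + degree (map shift (thEdges π)) (suc y)
    ≡⟨ cong₂ _+_ (degree-star-suc a y) (degree-shift-suc (thEdges π) y) ⟩
  below y a + thDegree π y                                       ∎

raise : ∀ {b c π} → b ≤ c → Linked _>_ (b ∷ π) → Linked _>_ (c ∷ π)
raise b≤c [-]           = [-]
raise b≤c (a<b ∷ chain) = <-≤-trans a<b b≤c ∷ chain

-- If b > a₀ > a₁ > ⋯ then every vertex x ≥ b is isolated in Th(π): an edge
-- {s, s + j} has j ≤ a_s ≤ a₀ - s, so both endpoints are at most a₀ < b.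
thDegree-vanishes : ∀ {b π x} → Linked _>_ (b ∷ π) → b ≤ x → thDegree π x ≡ 0
thDegree-vanishes {π = []}                 _             _   = refl
thDegree-vanishes {π = a ∷ as} {x = zero}  (a<b ∷ _)     b≤0 = contradiction (<-≤-trans a<b b≤0) n≮0
thDegree-vanishes {π = a ∷ as} {x = suc y} (a<b ∷ chain) b≤x = begin
  thDegree (a ∷ as) (suc y)   ≡⟨ thDegree-suc a as y ⟩
  below y a + thDegree as y   ≡⟨ cong₂ _+_ (below-no a≤y) (thDegree-vanishes chain a≤y) ⟩
  0                           ∎
  where
  a≤y : a ≤ y
  a≤y = ≤-pred (<-≤-trans a<b b≤x)

-- Squaring d_{a∷π}(y+1) = [y < a] + d_π(y): the cross term is 2·d_π(y), since
-- d_π(y) vanishes unless y < a.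
thDegree-suc-squared : ∀ {a π} → Linked _>_ (a ∷ π) → ∀ y →
  thDegree (a ∷ π) (suc y) ^ 2 ≡ below y a + 2 * thDegree π y + thDegree π y ^ 2
thDegree-suc-squared {a} {π} chain y rewrite thDegree-suc a π y with y <? a
... | yes y<a rewrite below-yes y<a = expand (thDegree π y)
  where
  expand : ∀ D → (1 + D) * ((1 + D) * 1) ≡ 1 + 2 * D + D * (D * 1)
  expand = solve-∀
... | no y≮a rewrite below-no (≮⇒≥ y≮a) | thDegree-vanishes chain (≮⇒≥ y≮a) = refl

handshake : ∀ {v} π → Linked _>_ (v ∷ π) → Σ v (thDegree π) ≡ 2 * length (thEdges π)
handshake {v} [] _ = Σ-zero v
handshake {suc v} (a ∷ as) (s≤s a≤v ∷ chain) = begin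
  thDegree (a ∷ as) 0 + Σ v (λ y → thDegree (a ∷ as) (suc y))
    ≡⟨ cong₂ _+_ (thDegree-zero a as) (Σ-cong v (thDegree-suc a as)) ⟩
  a + Σ v (λ y → below y a + thDegree as y)
    ≡⟨ cong (a +_) (Σ-+ v (λ y → below y a) (thDegree as)) ⟩
  a + (Σ v (λ y → below y a) + Σ v (thDegree as))
    ≡⟨ cong (a +_) (cong₂ _+_ (Σ-below v a a≤v) (handshake as (raise a≤v chain))) ⟩
  a + (a + 2 * m)
    ≡⟨ regroup a m ⟩
  2 * (a + m)
    ≡⟨ cong (2 *_) (sym (length-thEdges-∷ a as)) ⟩
  2 * length (thEdges (a ∷ as)) ∎
  where
  m = length (thEdges as)
  regroup : ∀ a m → a + (a + 2 * m) ≡ 2 * (a + m)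
  regroup = solve-∀

sum-of-squares : ∀ {v} π → Linked _>_ (v ∷ π) → Σ v (λ x → thDegree π x ^ 2) ≡ 2 * edgeWeight (thEdges π)
sum-of-squares {v} [] _ = Σ-zero v
sum-of-squares {suc v} (a ∷ as) (s≤s a≤v ∷ chain) = begin
  thDegree (a ∷ as) 0 ^ 2 + Σ v (λ y → thDegree (a ∷ as) (suc y) ^ 2)
    ≡⟨ cong₂ _+_ (cong (_^ 2) (thDegree-zero a as)) (Σ-cong v (thDegree-suc-squared chain)) ⟩
  a ^ 2 + Σ v (λ y → below y a + 2 * D y + D y ^ 2)
    ≡⟨ cong (a ^ 2 +_) (Σ-+ v (λ y → below y a + 2 * D y) (λ y → D y ^ 2)) ⟩
  a ^ 2 + (Σ v (λ y → below y a + 2 * D y) + Σ v (λ y → D y ^ 2))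
    ≡⟨ cong (λ z → a ^ 2 + (z + Σ v (λ y → D y ^ 2))) (Σ-+ v (λ y → below y a) (λ y → 2 * D y)) ⟩
  a ^ 2 + (Σ v (λ y → below y a) + Σ v (λ y → 2 * D y) + Σ v (λ y → D y ^ 2))
    ≡⟨ cong (λ z → a ^ 2 + (Σ v (λ y → below y a) + z + Σ v (λ y → D y ^ 2))) (Σ-* v 2 D) ⟩
  a ^ 2 + (Σ v (λ y → below y a) + 2 * Σ v D + Σ v (λ y → D y ^ 2))
    ≡⟨ cong (a ^ 2 +_) (cong₂ _+_ (cong₂ (λ p q → p + 2 * q) (Σ-below v a a≤v) (handshake as chain′))
                                  (sum-of-squares as chain′)) ⟩
  a ^ 2 + (a + 2 * (2 * m) + 2 * σ)
    ≡⟨ regroup a m σ ⟩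
  (a * a + a) + 2 * (σ + 2 * m)
    ≡⟨ cong (_+ 2 * (σ + 2 * m)) (sym (gauss a)) ⟩
  2 * Σ a suc + 2 * (σ + 2 * m)
    ≡⟨ sym (*-distribˡ-+ 2 (Σ a suc) _) ⟩
  2 * (Σ a suc + (σ + 2 * m))
    ≡⟨ cong (2 *_) (sym (edgeWeight-thEdges-∷ a as)) ⟩
  2 * edgeWeight (thEdges (a ∷ as)) ∎
  where
  D = thDegree as
  m = length (thEdges as)
  σ = edgeWeight (thEdges as)
  chain′ = raise a≤v chain
  regroup : ∀ a m s → a * (a * 1) + (a + 2 * (2 * m) + 2 * s) ≡ (a * a + a) + 2 * (s + 2 * m)
  regroup = solve-∀

weightedDiag≡edgeWeight : ∀ π → weightedDiag π ≡ edgeWeight (thEdges π)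
weightedDiag≡edgeWeight π = histogram weight (thEdges π) (diagLen π) ≤-refl

P₂≡Σ : ∀ v E → P₂ v E ≡ Σ v (λ x → degree E x ^ 2)
P₂≡Σ v E = cong sum (map-applyUpTo (λ x → x) (λ x → degree E x ^ 2) v)

dis⇒chain : ∀ {v e} π → Dis v e π → Linked _>_ (v ∷ π)
dis⇒chain []      _   = [-]
dis⇒chain (a ∷ _) dis = All.head (Dis.bounded dis) ∷ Dis.decreasing dis

lemma2 : (v e : ℕ) (π : List ℕ) → Dis v e π →
    P₂ v (thEdges π) ≡ 2 * weightedDiag π
lemma2 v e π dis = begin
  P₂ v (thEdges π)                 ≡⟨ P₂≡Σ v (thEdges π) ⟩
  Σ v (λ x → thDegree π x ^ 2)     ≡⟨ sum-of-squares π (dis⇒chain π dis) ⟩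
  2 * edgeWeight (thEdges π)       ≡⟨ cong (2 *_) (sym (weightedDiag≡edgeWeight π)) ⟩
  2 * weightedDiag π               ∎
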